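{- For $n\ge1$ write $$P_n(t)=\sum_{i}P_{n,i}t^i:=\sum_{\pi\in P^{\pm}(\{1,1,2,2,\ldots,n,n\})} t^{\operatorname{des}(\pi)},$$ with $P_{n,i}=0$ for $i<0$ or $i>2n-1$. Then for all $n\ge1$ and all integers $i$, $$P_{n+1,i}=(2i^2+3i+1)P_{n,i}+(2i(4n-2i+3)+2n+1)P_{n,i-1}+(2n+2-i)(4n-2i+5)P_{n,i-2}.$$
   Context: $P^{\pm}(\{1,1,2,2,\ldots,n,n\})$ is the set of signed permutations of the multiset $\{1,1,\ldots,n,n\}$: words $\pi_1\cdots\pi_{2n}$ of nonzero integers such that $|\pi_1|\cdots|\pi_{2n}|$ is an arrangement of the multiset, with each entry given an arbitrary sign. A descent of a word $\pi_1\cdots\pi_m$ is an index $i\in\{0,\ldots,m-1\}$ with $\pi_i>\pi_{i+1}$, where $\pi_0=0$; $\operatorname{des}(\pi)$ is the number of descents. -}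

module Defs where

open import Data.Nat as ℕ using (ℕ; zero; suc)
open import Data.Integer as ℤ using (ℤ; +_; -[1+_]; ∣_∣)
open import Data.List using (List; []; _∷_; [_]; map; concatMap; filter; length; upTo; _++_)
open import Data.List.Relation.Unary.All using (All)
open import Data.List.Relation.Unary.All as All using (all?)
open import Relation.Binary.PropositionalEquality using (_≡_)
open import Relation.Nullary using (does)
open import Data.Bool using (if_then_else_)

words : {A : Set} → ℕ → List A → List (List A)
words zero      alph = [ [] ]
words (suc m)   alph = concatMap (λ a → map (a ∷_) (words m alph)) alph

alphabet : ℕ → List ℤ
alphabet n = map (λ k → + suc k) (upTo n) ++ map (λ k → -[1+ k ]) (upTo n)

absMult : ℕ → List ℤ → ℕ
absMult k w = length (filter (λ x → ∣ x ∣ ℕ.≟ k) w)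

IsSignedPerm : ℕ → List ℤ → Set
IsSignedPerm n w = All (λ k → absMult (suc k) w ≡ 2) (upTo n)

signedPerms : ℕ → List (List ℤ)
signedPerms n =
  filter (λ w → all? (λ k → absMult (suc k) w ℕ.≟ 2) (upTo n))
         (words (2 ℕ.* n) (alphabet n))

descentsFrom : List ℤ → ℕ
descentsFrom []            = 0
descentsFrom (a ∷ [])      = 0
descentsFrom (a ∷ b ∷ r)   = (if does (b ℤ.<? a) then 1 else 0) ℕ.+ descentsFrom (b ∷ r)

-- des π with the convention π_0 = 0
des : List ℤ → ℕ
des w = descentsFrom (+ 0 ∷ w)

-- P_{n,i} = #{π ∈ P^±({1,1,...,n,n}) : des π = i}, for any integer i
-- (automatically 0 for i < 0 or i > 2n-1).
P : ℕ → ℤ → ℕ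
P n i = length (filter (λ w → + des w ℤ.≟ i) (signedPerms n))

-- Deleting the two letters of absolute value n+1 from a signed permutation of
-- {1,1,…,n+1,n+1} leaves one of {1,1,…,n,n}, and every signed permutation of the
-- larger multiset arises exactly once by inserting two letters ±(n+1) into one of
-- length 2n.  After π₀ = 0, a word with d descents and m further letters has m+1 gaps;
-- the maximum n+1 keeps the descent count in the d descent gaps and the final gap,
-- the minimum -(n+1) only in the d descent gaps, so one insertion gives 2d+1 words
-- with d descents and 2(m-d)+1 with d+1.  Inserting both letters, the same analysis
-- gives (2d+1)(d+1), 4d(m-d)+3d+5(m-d)+3 and (m-d)(2(m-d)+1) words with d, d+1 and
-- d+2 descents; with m = 2n and d = i, i-1, i-2 these are the three coefficients of
-- the recurrence.

module Submission where

open import Defs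
open import Data.Bool using (Bool; true; false; _∧_; if_then_else_)
import Data.Bool.Properties as Bool
open import Data.Integer as ℤ using (ℤ; +_; -[1+_]; _+_; _-_; _*_; ∣_∣)
import Data.Integer.Properties as ℤ
open import Data.Integer.Tactic.RingSolver using (solve-∀)
open import Data.List using (List; []; _∷_; [_]; map; concatMap; filter; length; upTo; _++_)
import Data.List.Properties as List
open import Data.List.Relation.Unary.All as All using (All; []; _∷_; all?)
import Data.List.Relation.Unary.All.Properties as All
open import Data.Nat as ℕ using (ℕ; zero; suc; _≤_; z≤n; s≤s)
import Data.Nat.Properties as ℕ
open import Function using (_∘_)
open import Level using (0ℓ)
open import Relation.Binary.PropositionalEquality hiding ([_])
open import Relation.Nullary using (does; yes; no; Dec; ¬_)
open import Relation.Nullary.Decidable using (dec-true; dec-false)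
open import Relation.Unary using (Decidable; Pred)

∑ : {A : Set} → List A → (A → ℤ) → ℤ
∑ []       f = + 0
∑ (x ∷ xs) f = f x + ∑ xs f

syntax ∑ xs (λ x → e) = ∑[ x ∈ xs ] e

module _ {A : Set} where

  ∑-++ : (xs ys : List A) (f : A → ℤ) → ∑ (xs ++ ys) f ≡ ∑ xs f + ∑ ys f
  ∑-++ []       ys f = sym (ℤ.+-identityˡ _)
  ∑-++ (x ∷ xs) ys f = trans (cong (_+_ (f x)) (∑-++ xs ys f)) (sym (ℤ.+-assoc (f x) _ _))

  ∑-cong-All : {Q : A → Set} {xs : List A} {f g : A → ℤ} →
               All Q xs → (∀ {x} → Q x → f x ≡ g x) → ∑ xs f ≡ ∑ xs g
  ∑-cong-All []       e = refl
  ∑-cong-All (q ∷ qs) e = cong₂ _+_ (e q) (∑-cong-All qs e)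

  ∑-cong : (xs : List A) {f g : A → ℤ} → (∀ x → f x ≡ g x) → ∑ xs f ≡ ∑ xs g
  ∑-cong []       e = refl
  ∑-cong (x ∷ xs) e = cong₂ _+_ (e x) (∑-cong xs e)

  ∑-zero : (xs : List A) → ∑[ x ∈ xs ] (+ 0) ≡ + 0
  ∑-zero []       = refl
  ∑-zero (x ∷ xs) = trans (ℤ.+-identityˡ _) (∑-zero xs)

  ∑-+ : (xs : List A) (f g : A → ℤ) → ∑[ x ∈ xs ] (f x + g x) ≡ ∑ xs f + ∑ xs g
  ∑-+ []       f g = refl
  ∑-+ (x ∷ xs) f g = trans (cong (_+_ (f x + g x)) (∑-+ xs f g)) (swap (f x) (g x) _ _)
    where
    swap : ∀ a b c d → a + b + (c + d) ≡ a + c + (b + d)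
    swap = solve-∀

  ∑-+₃ : (xs : List A) (f g h : A → ℤ) →
         ∑[ x ∈ xs ] (f x + g x + h x) ≡ ∑ xs f + ∑ xs g + ∑ xs h
  ∑-+₃ xs f g h = trans (∑-+ xs _ h) (cong (_+ ∑ xs h) (∑-+ xs f g))

  ∑-*ˡ : (xs : List A) (c : ℤ) (f : A → ℤ) → ∑[ x ∈ xs ] (c * f x) ≡ c * ∑ xs f
  ∑-*ˡ []       c f = sym (ℤ.*-zeroʳ c)
  ∑-*ˡ (x ∷ xs) c f = trans (cong (_+_ (c * f x)) (∑-*ˡ xs c f)) (sym (ℤ.*-distribˡ-+ c (f x) _))

  length≡∑1 : (xs : List A) → + length xs ≡ ∑[ x ∈ xs ] (+ 1)
  length≡∑1 []       = refl
  length≡∑1 (x ∷ xs) = cong (_+_ (+ 1)) (length≡∑1 xs)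

∑-*-+₃ : {A : Set} (xs : List A) (r f g h : A → ℤ) (a b c : ℤ) →
  ∑[ x ∈ xs ] (r x * (a * f x + b * g x + c * h x))
  ≡ a * ∑[ x ∈ xs ] (r x * f x) + b * ∑[ x ∈ xs ] (r x * g x) + c * ∑[ x ∈ xs ] (r x * h x)
∑-*-+₃ xs r f g h a b c =
  trans (∑-cong xs (λ x → distribute (r x) a b c (f x) (g x) (h x)))
        (trans (∑-+₃ xs _ _ _) (cong₂ _+_ (cong₂ _+_ (∑-*ˡ xs a _) (∑-*ˡ xs b _)) (∑-*ˡ xs c _)))
  where
  distribute : ∀ r a b c x y z → r * (a * x + b * y + c * z) ≡ a * (r * x) + b * (r * y) + c * (r * z)
  distribute = solve-∀

module _ {A B : Set} where

  ∑-map : (g : A → B) (xs : List A) (f : B → ℤ) → ∑ (map g xs) f ≡ ∑ xs (f ∘ g)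
  ∑-map g []       f = refl
  ∑-map g (x ∷ xs) f = cong (_+_ (f (g x))) (∑-map g xs f)

  ∑-concatMap : (h : A → List B) (xs : List A) (f : B → ℤ) →
                ∑ (concatMap h xs) f ≡ ∑[ x ∈ xs ] ∑ (h x) f
  ∑-concatMap h []       f = refl
  ∑-concatMap h (x ∷ xs) f =
    trans (∑-++ (h x) (concatMap h xs) f) (cong (_+_ (∑ (h x) f)) (∑-concatMap h xs f))

𝟙 : Bool → ℤ
𝟙 true  = + 1
𝟙 false = + 0

𝟙-∧ : ∀ a b → 𝟙 (a ∧ b) ≡ 𝟙 a * 𝟙 b
𝟙-∧ true  b = sym (ℤ.*-identityˡ _)
𝟙-∧ false b = refl

∑-filter : {A : Set} {Q : Pred A 0ℓ} (Q? : Decidable Q) (xs : List A) (f : A → ℤ) →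
           ∑ (filter Q? xs) f ≡ ∑[ x ∈ xs ] (𝟙 (does (Q? x)) * f x)
∑-filter Q? []       f = refl
∑-filter Q? (x ∷ xs) f with does (Q? x)
... | true  = cong₂ _+_ (sym (ℤ.*-identityˡ (f x))) (∑-filter Q? xs f)
... | false = trans (∑-filter Q? xs f) (sym (ℤ.+-identityˡ _))

does-⇔ : {X Y : Set} → (X → Y) → (Y → X) → (x? : Dec X) (y? : Dec Y) → does x? ≡ does y?
does-⇔ f g (yes x) y? = sym (dec-true y? (f x))
does-⇔ f g (no ¬x) y? = sym (dec-false y? (¬x ∘ g))

module _ {A : Set} {Q R : Pred A 0ℓ} (Q? : Decidable Q) (R? : Decidable R) where

  does-all?-cong : ∀ {xs} → All (λ x → does (Q? x) ≡ does (R? x)) xs →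
                   does (all? Q? xs) ≡ does (all? R? xs)
  does-all?-cong []       = refl
  does-all?-cong (e ∷ es) = cong₂ _∧_ e (does-all?-cong es)

does-all?-∷ʳ : {A : Set} {Q : Pred A 0ℓ} (Q? : Decidable Q) (xs : List A) (x : A) →
               does (all? Q? (xs ++ [ x ])) ≡ does (all? Q? xs) ∧ does (Q? x)
does-all?-∷ʳ Q? []       x = Bool.∧-identityʳ (does (Q? x))
does-all?-∷ʳ Q? (y ∷ xs) x =
  trans (cong (does (Q? y) ∧_) (does-all?-∷ʳ Q? xs x)) (sym (Bool.∧-assoc (does (Q? y)) _ _))

∑-words-suc : {A : Set} (m : ℕ) (as : List A) (f : List A → ℤ) →
              ∑ (words (suc m) as) f ≡ ∑[ a ∈ as ] ∑[ w ∈ words m as ] f (a ∷ w)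
∑-words-suc m as f =
  trans (∑-concatMap _ as f) (∑-cong as (λ a → ∑-map (a ∷_) (words m as) f))

∑-words-cong-All : {A : Set} {Q : A → Set} (m : ℕ) {as : List A} {f g : List A → ℤ} →
                   All Q as → (∀ {w} → length w ≡ m → All Q w → f w ≡ g w) →
                   ∑ (words m as) f ≡ ∑ (words m as) g
∑-words-cong-All zero    qs e = cong (_+ + 0) (e refl [])
∑-words-cong-All (suc m) {as} {f} {g} qs e = begin
  ∑ (words (suc m) as) f                          ≡⟨ ∑-words-suc m as f ⟩
  ∑[ a ∈ as ] ∑[ w ∈ words m as ] f (a ∷ w)       ≡⟨ ∑-cong-All qs (λ qa →
                                                       ∑-words-cong-All m qs (λ lw qw → e (cong suc lw) (qa ∷ qw))) ⟩
  ∑[ a ∈ as ] ∑[ w ∈ words m as ] g (a ∷ w)       ≡⟨ ∑-words-suc m as g ⟨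
  ∑ (words (suc m) as) g                          ∎
  where open ≡-Reasoning

∑-map-upTo-suc : (g : ℕ → ℤ) (n : ℕ) (φ : ℤ → ℤ) →
                 ∑ (map g (upTo (suc n))) φ ≡ ∑ (map g (upTo n)) φ + φ (g n)
∑-map-upTo-suc g n φ = begin
  ∑ (map g (upTo (suc n))) φ             ≡⟨ cong (λ ks → ∑ (map g ks) φ) (List.upTo-∷ʳ n) ⟨
  ∑ (map g (upTo n ++ [ n ])) φ          ≡⟨ cong (λ xs → ∑ xs φ) (List.map-++ g (upTo n) [ n ]) ⟩
  ∑ (map g (upTo n) ++ [ g n ]) φ        ≡⟨ ∑-++ (map g (upTo n)) [ g n ] φ ⟩
  ∑ (map g (upTo n)) φ + (φ (g n) + + 0) ≡⟨ cong (_+_ (∑ (map g (upTo n)) φ)) (ℤ.+-identityʳ _) ⟩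
  ∑ (map g (upTo n)) φ + φ (g n)         ∎
  where open ≡-Reasoning

∑-alphabet-suc : (n : ℕ) (φ : ℤ → ℤ) →
                 ∑ (alphabet (suc n)) φ ≡ ∑ (alphabet n) φ + φ (+ suc n) + φ (-[1+ n ])
∑-alphabet-suc n φ = begin
  ∑ (alphabet (suc n)) φ
    ≡⟨ ∑-++ (map pos (upTo (suc n))) _ φ ⟩
  ∑ (map pos (upTo (suc n))) φ + ∑ (map neg (upTo (suc n))) φ
    ≡⟨ cong₂ _+_ (∑-map-upTo-suc pos n φ) (∑-map-upTo-suc neg n φ) ⟩
  ∑ (map pos (upTo n)) φ + φ (+ suc n) + (∑ (map neg (upTo n)) φ + φ (-[1+ n ]))
    ≡⟨ shuffle (∑ (map pos (upTo n)) φ) (φ (+ suc n)) (∑ (map neg (upTo n)) φ) (φ (-[1+ n ])) ⟩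
  ∑ (map pos (upTo n)) φ + ∑ (map neg (upTo n)) φ + φ (+ suc n) + φ (-[1+ n ])
    ≡⟨ cong (λ s → s + φ (+ suc n) + φ (-[1+ n ])) (∑-++ (map pos (upTo n)) _ φ) ⟨
  ∑ (alphabet n) φ + φ (+ suc n) + φ (-[1+ n ])
    ∎
  where
  open ≡-Reasoning
  pos neg : ℕ → ℤ
  pos k = + suc k
  neg k = -[1+ k ]
  shuffle : ∀ a x b y → a + x + (b + y) ≡ a + b + x + y
  shuffle = solve-∀

Interior : ℕ → ℤ → Set
Interior n a = ∣ a ∣ ≤ n

min<interior : ∀ {n a} → Interior n a → -[1+ n ] ℤ.< a
min<interior {a = + _}      _   = ℤ.-<+
min<interior {a = -[1+ _ ]} k<n = ℤ.-<- k<n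

interior<max : ∀ {n a} → Interior n a → a ℤ.< + suc n
interior<max {a = + _}      k≤n = ℤ.+<+ (s≤s k≤n)
interior<max {a = -[1+ _ ]} _   = ℤ.-<+

alphabet-interior : ∀ n → All (Interior n) (alphabet n)
alphabet-interior n = All.++⁺ (All.map⁺ (All.applyUpTo⁺₁ _ n (λ k<n → k<n)))
                              (All.map⁺ (All.applyUpTo⁺₁ _ n (λ k<n → k<n)))

absMult-miss : ∀ {k} a w → ∣ a ∣ ≢ k → absMult k (a ∷ w) ≡ absMult k w
absMult-miss {k} a w ∣a∣≢k = cong length (List.filter-reject (λ x → ∣ x ∣ ℕ.≟ k) {a} {w} ∣a∣≢k)

absMult-hit : ∀ {k} a w → ∣ a ∣ ≡ k → absMult k (a ∷ w) ≡ suc (absMult k w)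
absMult-hit {k} a w ∣a∣≡k = cong length (List.filter-accept (λ x → ∣ x ∣ ℕ.≟ k) {a} {w} ∣a∣≡k)

absMult-++ : ∀ k u w → absMult k (u ++ w) ≡ absMult k u ℕ.+ absMult k w
absMult-++ k u w =
  trans (cong length (List.filter-++ (λ x → ∣ x ∣ ℕ.≟ k) u w)) (List.length-++ (filter (λ x → ∣ x ∣ ℕ.≟ k) u))

absMult-insert-miss : ∀ {k x} u w → ∣ x ∣ ≢ k → absMult k (u ++ x ∷ w) ≡ absMult k (u ++ w)
absMult-insert-miss {k} {x} u w ∣x∣≢k = begin
  absMult k (u ++ x ∷ w)             ≡⟨ absMult-++ k u (x ∷ w) ⟩
  absMult k u ℕ.+ absMult k (x ∷ w)  ≡⟨ cong (absMult k u ℕ.+_) (absMult-miss x w ∣x∣≢k) ⟩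
  absMult k u ℕ.+ absMult k w        ≡⟨ absMult-++ k u w ⟨
  absMult k (u ++ w)                 ∎
  where open ≡-Reasoning

absMult≤length : ∀ k w → absMult k w ≤ length w
absMult≤length k = List.length-filter (λ x → ∣ x ∣ ℕ.≟ k)

δ : ℤ → ℕ → ℤ
δ i e = 𝟙 (does (+ e ℤ.≟ i))

δ-+ : ∀ s i e → δ i (s ℕ.+ e) ≡ δ (i - + s) e
δ-+ s i e = cong 𝟙 (does-⇔ (λ eq → trans (sym (cancel (+ s) (+ e))) (cong (_- + s) eq))
                           (λ eq → trans (cong (_+_ (+ s)) eq) (uncancel (+ s) i))
                           (+ (s ℕ.+ e) ℤ.≟ i) (+ e ℤ.≟ i - + s))
  where
  cancel : ∀ S E → S + E - S ≡ E
  cancel = solve-∀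
  uncancel : ∀ S I → S + (I - S) ≡ I
  uncancel = solve-∀

δ-coeff : ∀ (f : ℤ → ℤ) i e → f (+ e) * δ i e ≡ f i * δ i e
δ-coeff f i e with + e ℤ.≟ i
... | yes e≡i = cong (_* + 1) (cong f e≡i)
... | no  _   = trans (ℤ.*-zeroʳ (f (+ e))) (sym (ℤ.*-zeroʳ (f i)))

δ-coeff-+ : ∀ s (f : ℤ → ℤ) i e → f (+ (s ℕ.+ e)) * δ i (s ℕ.+ e) ≡ f i * δ (i - + s) e
δ-coeff-+ s f i e = trans (δ-coeff f i (s ℕ.+ e)) (cong (f i *_) (δ-+ s i e))

isSignedPermᵇ : ℕ → List ℤ → Bool
isSignedPermᵇ n w = does (all? (λ k → absMult (suc k) w ℕ.≟ 2) (upTo n))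

P≡∑ : ∀ n i → + P n i ≡ ∑[ w ∈ words (2 ℕ.* n) (alphabet n) ] (𝟙 (isSignedPermᵇ n w) * δ i (des w))
P≡∑ n i = begin
  + length (filter des≡i? (filter signed? W))                 ≡⟨ length≡∑1 (filter des≡i? (filter signed? W)) ⟩
  ∑[ w ∈ filter des≡i? (filter signed? W) ] (+ 1)            ≡⟨ ∑-filter des≡i? (filter signed? W) _ ⟩
  ∑[ w ∈ filter signed? W ] (δ i (des w) * + 1)              ≡⟨ ∑-filter signed? W _ ⟩
  ∑[ w ∈ W ] (𝟙 (isSignedPermᵇ n w) * (δ i (des w) * + 1))   ≡⟨ ∑-cong W (λ w → cong (𝟙 (isSignedPermᵇ n w) *_) (ℤ.*-identityʳ _)) ⟩
  ∑[ w ∈ W ] (𝟙 (isSignedPermᵇ n w) * δ i (des w))           ∎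
  where
  open ≡-Reasoning
  W = words (2 ℕ.* n) (alphabet n)
  des≡i? = λ w → + des w ℤ.≟ i
  signed? = λ w → all? (λ k → absMult (suc k) w ℕ.≟ 2) (upTo n)

𝟙-tops : ℕ → ℕ → List ℤ → ℤ
𝟙-tops n k w = 𝟙 (does (absMult (suc n) w ℕ.≟ k))

𝟙-tops-interior : ∀ {n} a k w → Interior n a → 𝟙-tops n k (a ∷ w) ≡ 𝟙-tops n k w
𝟙-tops-interior {n} a k w ∣a∣≤n =
  cong (λ c → 𝟙 (does (c ℕ.≟ k))) (absMult-miss a w λ ∣a∣≡1+n → ℕ.<-irrefl ∣a∣≡1+n (s≤s ∣a∣≤n))

-- does (suc c ℕ.≟ suc k) computes to does (c ℕ.≟ k).
𝟙-tops-top : ∀ {n} x k w → ∣ x ∣ ≡ suc n → 𝟙-tops n (suc k) (x ∷ w) ≡ 𝟙-tops n k w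
𝟙-tops-top x k w ∣x∣≡1+n = cong (λ c → 𝟙 (does (c ℕ.≟ suc k))) (absMult-hit x w ∣x∣≡1+n)

𝟙-tops-top-zero : ∀ {n} x w → ∣ x ∣ ≡ suc n → 𝟙-tops n 0 (x ∷ w) ≡ + 0
𝟙-tops-top-zero x w ∣x∣≡1+n = cong (λ c → 𝟙 (does (c ℕ.≟ 0))) (absMult-hit x w ∣x∣≡1+n)

𝟙-tops-short : ∀ n {k} w → length w ≡ k → 𝟙-tops n (suc k) w ≡ + 0
𝟙-tops-short n w refl = cong 𝟙 (dec-false (absMult (suc n) w ℕ.≟ _)
  λ tops≡1+len → ℕ.<-irrefl tops≡1+len (s≤s (absMult≤length (suc n) w)))

𝟙-isSignedPermᵇ-suc : ∀ n w → 𝟙 (isSignedPermᵇ (suc n) w) ≡ 𝟙 (isSignedPermᵇ n w) * 𝟙-tops n 2 w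
𝟙-isSignedPermᵇ-suc n w = begin
  𝟙 (does (all? twice? (upTo (suc n))))              ≡⟨ cong (λ ks → 𝟙 (does (all? twice? ks))) (List.upTo-∷ʳ n) ⟨
  𝟙 (does (all? twice? (upTo n ++ [ n ])))           ≡⟨ cong 𝟙 (does-all?-∷ʳ twice? (upTo n) n) ⟩
  𝟙 (does (all? twice? (upTo n)) ∧ does (twice? n))  ≡⟨ 𝟙-∧ (does (all? twice? (upTo n))) (does (twice? n)) ⟩
  𝟙 (isSignedPermᵇ n w) * 𝟙-tops n 2 w               ∎
  where
  open ≡-Reasoning
  twice? = λ k → absMult (suc k) w ℕ.≟ 2

isSignedPermᵇ-insert-top : ∀ n {x} u w → ∣ x ∣ ≡ suc n →
                           isSignedPermᵇ n (u ++ x ∷ w) ≡ isSignedPermᵇ n (u ++ w)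
isSignedPermᵇ-insert-top n u w ∣x∣≡1+n = does-all?-cong _ _ (All.applyUpTo⁺₁ _ n λ k<n →
  cong (λ c → does (c ℕ.≟ 2)) (absMult-insert-miss u w λ ∣x∣≡1+k →
    ℕ.<-irrefl (ℕ.suc-injective (trans (sym ∣x∣≡1+k) ∣x∣≡1+n)) k<n))

-- insertSum n k g v sums g over all words obtained from v by inserting k letters,
-- each +(n+1) or -(n+1): one term per choice of positions and signs.
insertSum : ℕ → ℕ → (List ℤ → ℤ) → List ℤ → ℤ
insertSum n zero    g v       = g v
insertSum n (suc k) g []      =
  insertSum n k (g ∘ (+ suc n ∷_)) [] + insertSum n k (g ∘ (-[1+ n ] ∷_)) []
insertSum n (suc k) g (a ∷ v) =
  insertSum n k (g ∘ (+ suc n ∷_)) (a ∷ v) + insertSum n k (g ∘ (-[1+ n ] ∷_)) (a ∷ v)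
  + insertSum n (suc k) (g ∘ (a ∷_)) v

insertSum-cong : ∀ n k v {g h : List ℤ → ℤ} → (∀ w → g w ≡ h w) → insertSum n k g v ≡ insertSum n k h v
insertSum-cong n zero    v       e = e v
insertSum-cong n (suc k) []      e =
  cong₂ _+_ (insertSum-cong n k [] (e ∘ _)) (insertSum-cong n k [] (e ∘ _))
insertSum-cong n (suc k) (a ∷ v) e =
  cong₂ _+_ (cong₂ _+_ (insertSum-cong n k (a ∷ v) (e ∘ _)) (insertSum-cong n k (a ∷ v) (e ∘ _)))
            (insertSum-cong n (suc k) v (e ∘ _))

module _ (n : ℕ) (ρ : List ℤ → ℤ)
         (ρ-insert-top : ∀ {x} u w → ∣ x ∣ ≡ suc n → ρ (u ++ x ∷ w) ≡ ρ (u ++ w)) where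

  insertSum-*ˡ : ∀ k u v (g : List ℤ → ℤ) →
                 insertSum n k (λ w → ρ (u ++ w) * g w) v ≡ ρ (u ++ v) * insertSum n k g v
  insertSum-*ˡ-top : ∀ k {x} u v (g : List ℤ → ℤ) → ∣ x ∣ ≡ suc n →
                     insertSum n k (λ w → ρ (u ++ x ∷ w) * g (x ∷ w)) v
                     ≡ ρ (u ++ v) * insertSum n k (g ∘ (x ∷_)) v

  insertSum-*ˡ zero    u v       g = refl
  insertSum-*ˡ (suc k) u []      g =
    trans (cong₂ _+_ (insertSum-*ˡ-top k u [] g refl) (insertSum-*ˡ-top k u [] g refl))
          (sym (ℤ.*-distribˡ-+ (ρ (u ++ [])) _ _))
  insertSum-*ˡ (suc k) u (a ∷ v) g = begin
    insertSum n k (λ w → ρ (u ++ + suc n ∷ w) * g (+ suc n ∷ w)) (a ∷ v)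
    + insertSum n k (λ w → ρ (u ++ -[1+ n ] ∷ w) * g (-[1+ n ] ∷ w)) (a ∷ v)
    + insertSum n (suc k) (λ w → ρ (u ++ a ∷ w) * g (a ∷ w)) v
      ≡⟨ cong₂ _+_ (cong₂ _+_ (insertSum-*ˡ-top k u (a ∷ v) g refl) (insertSum-*ˡ-top k u (a ∷ v) g refl))
                   (insertSum-cong n (suc k) v (λ w → cong (λ z → ρ z * g (a ∷ w)) (sym (List.++-assoc u [ a ] w)))) ⟩
    ρ (u ++ a ∷ v) * insertSum n k (g ∘ (+ suc n ∷_)) (a ∷ v)
    + ρ (u ++ a ∷ v) * insertSum n k (g ∘ (-[1+ n ] ∷_)) (a ∷ v)
    + insertSum n (suc k) (λ w → ρ ((u ++ [ a ]) ++ w) * g (a ∷ w)) v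
      ≡⟨ cong (_+_ (ρ (u ++ a ∷ v) * insertSum n k (g ∘ (+ suc n ∷_)) (a ∷ v)
                    + ρ (u ++ a ∷ v) * insertSum n k (g ∘ (-[1+ n ] ∷_)) (a ∷ v))) (trans (insertSum-*ˡ (suc k) (u ++ [ a ]) v (g ∘ (a ∷_)))
                            (cong (λ z → ρ z * _) (List.++-assoc u [ a ] v))) ⟩
    ρ (u ++ a ∷ v) * insertSum n k (g ∘ (+ suc n ∷_)) (a ∷ v)
    + ρ (u ++ a ∷ v) * insertSum n k (g ∘ (-[1+ n ] ∷_)) (a ∷ v)
    + ρ (u ++ a ∷ v) * insertSum n (suc k) (g ∘ (a ∷_)) v
      ≡⟨ factor (ρ (u ++ a ∷ v)) _ _ _ ⟩
    ρ (u ++ a ∷ v) * insertSum n (suc k) g (a ∷ v)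
      ∎
    where
    open ≡-Reasoning
    factor : ∀ r x y z → r * x + r * y + r * z ≡ r * (x + y + z)
    factor = solve-∀

  insertSum-*ˡ-top k u v g ∣x∣≡1+n =
    trans (insertSum-cong n k v (λ w → cong (_* g _) (ρ-insert-top u w ∣x∣≡1+n)))
          (insertSum-*ˡ k u v (g ∘ (_ ∷_)))

module _ (n : ℕ) where

  private
    A A' : List ℤ
    A  = alphabet n
    A' = alphabet (suc n)

  ∑-tops-words-suc-zero : ∀ l (g : List ℤ → ℤ) →
    ∑[ w ∈ words (suc l) A' ] (𝟙-tops n 0 w * g w)
    ≡ ∑[ a ∈ A ] ∑[ w ∈ words l A' ] (𝟙-tops n 0 w * g (a ∷ w))
  ∑-tops-words-suc-zero l g = begin
    ∑[ w ∈ words (suc l) A' ] (𝟙-tops n 0 w * g w)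
      ≡⟨ trans (∑-words-suc l A' _) (∑-alphabet-suc n _) ⟩
    ∑[ a ∈ A ] ∑[ w ∈ W ] (𝟙-tops n 0 (a ∷ w) * g (a ∷ w))
    + ∑[ w ∈ W ] (𝟙-tops n 0 (+ suc n ∷ w) * g (+ suc n ∷ w))
    + ∑[ w ∈ W ] (𝟙-tops n 0 (-[1+ n ] ∷ w) * g (-[1+ n ] ∷ w))
      ≡⟨ cong₂ _+_ (cong₂ _+_ (∑-cong-All (alphabet-interior n) λ {a} a∈ →
                                 ∑-cong W λ w → cong (_* g _) (𝟙-tops-interior a 0 w a∈))
                              (no-top (+ suc n) refl))
                   (no-top -[1+ n ] refl) ⟩
    ∑[ a ∈ A ] ∑[ w ∈ W ] (𝟙-tops n 0 w * g (a ∷ w)) + + 0 + + 0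
      ≡⟨ trans (ℤ.+-identityʳ _) (ℤ.+-identityʳ _) ⟩
    ∑[ a ∈ A ] ∑[ w ∈ W ] (𝟙-tops n 0 w * g (a ∷ w))
      ∎
    where
    open ≡-Reasoning
    W = words l A'
    no-top : ∀ x → ∣ x ∣ ≡ suc n → ∑[ w ∈ W ] (𝟙-tops n 0 (x ∷ w) * g (x ∷ w)) ≡ + 0
    no-top x ∣x∣≡1+n = trans (∑-cong W λ w → cong (_* g _) (𝟙-tops-top-zero x w ∣x∣≡1+n)) (∑-zero W)

  ∑-tops-words-suc : ∀ k l (g : List ℤ → ℤ) →
    ∑[ w ∈ words (suc l) A' ] (𝟙-tops n (suc k) w * g w)
    ≡ ∑[ a ∈ A ] ∑[ w ∈ words l A' ] (𝟙-tops n (suc k) w * g (a ∷ w))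
      + ∑[ w ∈ words l A' ] (𝟙-tops n k w * g (+ suc n ∷ w))
      + ∑[ w ∈ words l A' ] (𝟙-tops n k w * g (-[1+ n ] ∷ w))
  ∑-tops-words-suc k l g =
    trans (trans (∑-words-suc l A' _) (∑-alphabet-suc n _))
          (cong₂ _+_ (cong₂ _+_ (∑-cong-All (alphabet-interior n) λ {a} a∈ →
                                   ∑-cong W λ w → cong (_* g _) (𝟙-tops-interior a (suc k) w a∈))
                                (top (+ suc n) refl))
                     (top -[1+ n ] refl))
    where
    W = words l A'
    top : ∀ x → ∣ x ∣ ≡ suc n →
          ∑[ w ∈ W ] (𝟙-tops n (suc k) (x ∷ w) * g (x ∷ w)) ≡ ∑[ w ∈ W ] (𝟙-tops n k w * g (x ∷ w))
    top x ∣x∣≡1+n = ∑-cong W λ w → cong (_* g _) (𝟙-tops-top x k w ∣x∣≡1+n)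

  ∑-words-insertSum-suc : ∀ k m (g : List ℤ → ℤ) →
    ∑ (words (suc m) A) (insertSum n (suc k) g)
    ≡ ∑ (words (suc m) A) (insertSum n k (g ∘ (+ suc n ∷_)))
      + ∑ (words (suc m) A) (insertSum n k (g ∘ (-[1+ n ] ∷_)))
      + ∑[ a ∈ A ] ∑ (words m A) (insertSum n (suc k) (g ∘ (a ∷_)))
  ∑-words-insertSum-suc k m g = begin
    ∑ (words (suc m) A) (insertSum n (suc k) g)
      ≡⟨ ∑-words-suc m A _ ⟩
    ∑[ a ∈ A ] ∑[ v ∈ words m A ] (X a v + Y a v + Z a v)
      ≡⟨ ∑-cong A (λ a → ∑-+₃ (words m A) (X a) (Y a) (Z a)) ⟩
    ∑[ a ∈ A ] (∑ (words m A) (X a) + ∑ (words m A) (Y a) + ∑ (words m A) (Z a))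
      ≡⟨ ∑-+₃ A _ _ _ ⟩
    ∑[ a ∈ A ] ∑ (words m A) (X a) + ∑[ a ∈ A ] ∑ (words m A) (Y a) + ∑[ a ∈ A ] ∑ (words m A) (Z a)
      ≡⟨ cong₂ (λ x y → x + y + ∑[ a ∈ A ] ∑ (words m A) (Z a)) (∑-words-suc m A _) (∑-words-suc m A _) ⟨
    ∑ (words (suc m) A) (insertSum n k (g ∘ (+ suc n ∷_)))
    + ∑ (words (suc m) A) (insertSum n k (g ∘ (-[1+ n ] ∷_)))
    + ∑[ a ∈ A ] ∑ (words m A) (insertSum n (suc k) (g ∘ (a ∷_)))
      ∎
    where
    open ≡-Reasoning
    X Y Z : ℤ → List ℤ → ℤ
    X a v = insertSum n k (g ∘ (+ suc n ∷_)) (a ∷ v)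
    Y a v = insertSum n k (g ∘ (-[1+ n ] ∷_)) (a ∷ v)
    Z a v = insertSum n (suc k) (g ∘ (a ∷_)) v

  ∑-words-insertSum : ∀ k m (g : List ℤ → ℤ) →
    ∑[ w ∈ words (m ℕ.+ k) A' ] (𝟙-tops n k w * g w) ≡ ∑ (words m A) (insertSum n k g)
  ∑-words-insertSum zero    zero    g = cong (_+ + 0) (ℤ.*-identityˡ (g []))
  ∑-words-insertSum zero    (suc m) g =
    trans (∑-tops-words-suc-zero (m ℕ.+ 0) g)
          (trans (∑-cong A λ a → ∑-words-insertSum 0 m (g ∘ (a ∷_))) (sym (∑-words-suc m A g)))
  ∑-words-insertSum (suc k) zero    g = begin
    ∑[ w ∈ words (suc k) A' ] (𝟙-tops n (suc k) w * g w)
      ≡⟨ ∑-tops-words-suc k k g ⟩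
    ∑[ a ∈ A ] ∑[ w ∈ words k A' ] (𝟙-tops n (suc k) w * g (a ∷ w))
    + ∑[ w ∈ words k A' ] (𝟙-tops n k w * gN w) + ∑[ w ∈ words k A' ] (𝟙-tops n k w * gM w)
      ≡⟨ cong₂ _+_ (cong₂ _+_ (trans (∑-cong A λ a → too-short (g ∘ (a ∷_))) (∑-zero A))
                              (∑-words-insertSum k 0 gN))
                   (∑-words-insertSum k 0 gM) ⟩
    + 0 + (insertSum n k gN [] + + 0) + (insertSum n k gM [] + + 0)
      ≡⟨ tidy (insertSum n k gN []) (insertSum n k gM []) ⟩
    insertSum n (suc k) g [] + + 0
      ∎
    where
    open ≡-Reasoning
    gN gM : List ℤ → ℤ
    gN = g ∘ (+ suc n ∷_)
    gM = g ∘ (-[1+ n ] ∷_)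
    too-short : (h : List ℤ → ℤ) → ∑[ w ∈ words k A' ] (𝟙-tops n (suc k) w * h w) ≡ + 0
    too-short h = trans (∑-words-cong-All k (alphabet-interior (suc n)) λ {w} len≡k _ →
                           trans (cong (_* h w) (𝟙-tops-short n w len≡k)) (ℤ.*-zeroˡ (h w)))
                        (∑-zero (words k A'))
    tidy : ∀ x y → + 0 + (x + + 0) + (y + + 0) ≡ x + y + + 0
    tidy = solve-∀
  ∑-words-insertSum (suc k) (suc m) g = begin
    ∑[ w ∈ words (suc (m ℕ.+ suc k)) A' ] (𝟙-tops n (suc k) w * g w)
      ≡⟨ ∑-tops-words-suc k (m ℕ.+ suc k) g ⟩
    ∑[ a ∈ A ] ∑[ w ∈ words (m ℕ.+ suc k) A' ] (𝟙-tops n (suc k) w * g (a ∷ w))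
    + ∑[ w ∈ words (m ℕ.+ suc k) A' ] (𝟙-tops n k w * gN w)
    + ∑[ w ∈ words (m ℕ.+ suc k) A' ] (𝟙-tops n k w * gM w)
      ≡⟨ cong₂ _+_ (cong₂ _+_ (∑-cong A λ a → ∑-words-insertSum (suc k) m (g ∘ (a ∷_)))
                              (top gN))
                   (top gM) ⟩
    Z + X + Y
      ≡⟨ rotate Z X Y ⟩
    X + Y + Z
      ≡⟨ ∑-words-insertSum-suc k m g ⟨
    ∑ (words (suc m) A) (insertSum n (suc k) g)
      ∎
    where
    open ≡-Reasoning
    gN gM : List ℤ → ℤ
    gN = g ∘ (+ suc n ∷_)
    gM = g ∘ (-[1+ n ] ∷_)
    X = ∑ (words (suc m) A) (insertSum n k gN)
    Y = ∑ (words (suc m) A) (insertSum n k gM)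
    Z = ∑[ a ∈ A ] ∑ (words m A) (insertSum n (suc k) (g ∘ (a ∷_)))
    top : (h : List ℤ → ℤ) →
          ∑[ w ∈ words (m ℕ.+ suc k) A' ] (𝟙-tops n k w * h w) ≡ ∑ (words (suc m) A) (insertSum n k h)
    top h = trans (cong (λ l → ∑[ w ∈ words l A' ] (𝟙-tops n k w * h w)) (ℕ.+-suc m k))
                  (∑-words-insertSum k (suc m) h)
    rotate : ∀ z x y → z + x + y ≡ x + y + z
    rotate = solve-∀

descentsFrom-descent : ∀ {p x} w → x ℤ.< p → descentsFrom (p ∷ x ∷ w) ≡ suc (descentsFrom (x ∷ w))
descentsFrom-descent {p} {x} w x<p rewrite dec-true (x ℤ.<? p) x<p = refl

descentsFrom-ascent : ∀ {p x} w → ¬ x ℤ.< p → descentsFrom (p ∷ x ∷ w) ≡ descentsFrom (x ∷ w)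
descentsFrom-ascent {p} {x} w x≮p rewrite dec-false (x ℤ.<? p) x≮p = refl

bit : Bool → ℕ
bit b = if b then 1 else 0

insert₁ : ℕ → ℕ → (ℕ → ℤ) → ℤ
insert₁ d m h = (+ 2 * + d + + 1) * h d + (+ 2 * (+ m - + d) + + 1) * h (suc d)

insert₂ : ℕ → ℕ → (ℕ → ℤ) → ℤ
insert₂ d m h =
  (+ 2 * + d + + 1) * (+ d + + 1) * h d
  + (+ 4 * + d * (+ m - + d) + + 3 * + d + + 5 * (+ m - + d) + + 3) * h (suc d)
  + (+ m - + d) * (+ 2 * (+ m - + d) + + 1) * h (suc (suc d))

insert₁-step : ∀ b d m (h : ℕ → ℤ) →
  h (suc d) + h (suc d) + insert₁ d m (λ e → h (bit b ℕ.+ e)) ≡ insert₁ (bit b ℕ.+ d) (suc m) h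
insert₁-step true  d m h = ring (+ d) (+ m) (h (suc d)) (h (suc (suc d)))
  where
  ring : ∀ D M X Y → X + X + ((+ 2 * D + + 1) * X + (+ 2 * (M - D) + + 1) * Y)
         ≡ (+ 2 * (+ 1 + D) + + 1) * X + (+ 2 * ((+ 1 + M) - (+ 1 + D)) + + 1) * Y
  ring = solve-∀
insert₁-step false d m h = ring (+ d) (+ m) (h d) (h (suc d))
  where
  ring : ∀ D M X Y → Y + Y + ((+ 2 * D + + 1) * X + (+ 2 * (M - D) + + 1) * Y)
         ≡ (+ 2 * D + + 1) * X + (+ 2 * ((+ 1 + M) - D) + + 1) * Y
  ring = solve-∀

insert₂-step : ∀ b d m (h : ℕ → ℤ) →
  insert₁ (suc d) (suc m) h + (h (suc (suc d)) + h (suc d) + insert₁ d m (h ∘ suc))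
  + insert₂ d m (λ e → h (bit b ℕ.+ e))
  ≡ insert₂ (bit b ℕ.+ d) (suc m) h
insert₂-step true  d m h = ring (+ d) (+ m) (h (suc d)) (h (suc (suc d))) (h (suc (suc (suc d))))
  where
  ring : ∀ D M X Y Z →
    (+ 2 * (+ 1 + D) + + 1) * X + (+ 2 * ((+ 1 + M) - (+ 1 + D)) + + 1) * Y
    + (Y + X + ((+ 2 * D + + 1) * X + (+ 2 * (M - D) + + 1) * Y))
    + ((+ 2 * D + + 1) * (D + + 1) * X + (+ 4 * D * (M - D) + + 3 * D + + 5 * (M - D) + + 3) * Y
       + (M - D) * (+ 2 * (M - D) + + 1) * Z)
    ≡ (+ 2 * (+ 1 + D) + + 1) * ((+ 1 + D) + + 1) * X
      + (+ 4 * (+ 1 + D) * ((+ 1 + M) - (+ 1 + D)) + + 3 * (+ 1 + D) + + 5 * ((+ 1 + M) - (+ 1 + D)) + + 3) * Y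
      + ((+ 1 + M) - (+ 1 + D)) * (+ 2 * ((+ 1 + M) - (+ 1 + D)) + + 1) * Z
  ring = solve-∀
insert₂-step false d m h = ring (+ d) (+ m) (h d) (h (suc d)) (h (suc (suc d)))
  where
  ring : ∀ D M W X Y →
    (+ 2 * (+ 1 + D) + + 1) * X + (+ 2 * ((+ 1 + M) - (+ 1 + D)) + + 1) * Y
    + (Y + X + ((+ 2 * D + + 1) * X + (+ 2 * (M - D) + + 1) * Y))
    + ((+ 2 * D + + 1) * (D + + 1) * W + (+ 4 * D * (M - D) + + 3 * D + + 5 * (M - D) + + 3) * X
       + (M - D) * (+ 2 * (M - D) + + 1) * Y)
    ≡ (+ 2 * D + + 1) * (D + + 1) * W
      + (+ 4 * D * ((+ 1 + M) - D) + + 3 * D + + 5 * ((+ 1 + M) - D) + + 3) * X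
      + ((+ 1 + M) - D) * (+ 2 * ((+ 1 + M) - D) + + 1) * Y
  ring = solve-∀

module _ (n : ℕ) where

  private
    N M : ℤ
    N = + suc n
    M = -[1+ n ]

    M<N : M ℤ.< N
    M<N = ℤ.-<+

    N≮M : ¬ N ℤ.< M
    N≮M = ℤ.<-asym M<N

    N≮N : ¬ N ℤ.< N
    N≮N = ℤ.<-irrefl refl

    M≮M : ¬ M ℤ.< M
    M≮M = ℤ.<-irrefl refl

  insertSum-descents₁ : ∀ {p} (h : ℕ → ℤ) v → M ℤ.< p → p ℤ.≤ N → All (Interior n) v →
    insertSum n 1 (h ∘ descentsFrom ∘ (p ∷_)) v ≡ insert₁ (descentsFrom (p ∷ v)) (length v) h
  insertSum-descents₁ h [] M<p p≤N [] =
    trans (cong₂ _+_ (cong h (descentsFrom-ascent [] (ℤ.≤⇒≯ p≤N))) (cong h (descentsFrom-descent [] M<p)))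
          (ring (h 0) (h 1))
    where
    ring : ∀ X Y → X + Y ≡ (+ 2 * + 0 + + 1) * X + (+ 2 * (+ 0 - + 0) + + 1) * Y
    ring = solve-∀
  -- descentsFrom (p ∷ a ∷ w) unfolds to bit b ℕ.+ descentsFrom (a ∷ w).
  insertSum-descents₁ {p} h (a ∷ v) M<p p≤N (a∈ ∷ v∈) = begin
    h (descentsFrom (p ∷ N ∷ a ∷ v)) + h (descentsFrom (p ∷ M ∷ a ∷ v))
    + insertSum n 1 (λ w → h (bit b ℕ.+ descentsFrom (a ∷ w))) v
      ≡⟨ cong₂ _+_ (cong₂ _+_ (cong h (trans (descentsFrom-ascent (a ∷ v) (ℤ.≤⇒≯ p≤N))
                                              (descentsFrom-descent v (interior<max a∈))))
                              (cong h (trans (descentsFrom-descent (a ∷ v) M<p)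
                                              (cong suc (descentsFrom-ascent v (ℤ.<-asym (min<interior a∈)))))))
                   (insertSum-descents₁ (λ e → h (bit b ℕ.+ e)) v (min<interior a∈) (ℤ.<⇒≤ (interior<max a∈)) v∈) ⟩
    h (suc d) + h (suc d) + insert₁ d (length v) (λ e → h (bit b ℕ.+ e))
      ≡⟨ insert₁-step b d (length v) h ⟩
    insert₁ (bit b ℕ.+ d) (suc (length v)) h
      ∎
    where
    open ≡-Reasoning
    b = does (a ℤ.<? p)
    d = descentsFrom (a ∷ v)

  insertSum-descents₁-after-min : ∀ (h : ℕ → ℤ) a v → Interior n a → All (Interior n) v →
    insertSum n 1 (h ∘ descentsFrom ∘ (M ∷_)) (a ∷ v)
    ≡ h (suc (descentsFrom (a ∷ v))) + h (descentsFrom (a ∷ v)) + insert₁ (descentsFrom (a ∷ v)) (length v) h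
  insertSum-descents₁-after-min h a v a∈ v∈ =
    cong₂ _+_ (cong₂ _+_ (cong h (trans (descentsFrom-ascent (a ∷ v) N≮M) (descentsFrom-descent v (interior<max a∈))))
                         (cong h (trans (descentsFrom-ascent (a ∷ v) M≮M) (descentsFrom-ascent v a≮M))))
              (trans (insertSum-cong n 1 v (λ w → cong h (descentsFrom-ascent w a≮M)))
                     (insertSum-descents₁ h v (min<interior a∈) (ℤ.<⇒≤ (interior<max a∈)) v∈))
    where
    a≮M = ℤ.<-asym (min<interior a∈)

  insertSum-descents₂ : ∀ {p} (h : ℕ → ℤ) v → M ℤ.< p → p ℤ.≤ N → All (Interior n) v →
    insertSum n 2 (h ∘ descentsFrom ∘ (p ∷_)) v ≡ insert₂ (descentsFrom (p ∷ v)) (length v) h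
  insertSum-descents₂ {p} h [] M<p p≤N [] = begin
    h (descentsFrom (p ∷ N ∷ N ∷ [])) + h (descentsFrom (p ∷ N ∷ M ∷ []))
    + (h (descentsFrom (p ∷ M ∷ N ∷ [])) + h (descentsFrom (p ∷ M ∷ M ∷ [])))
      ≡⟨ cong₂ _+_ (cong₂ _+_ (cong h (trans (descentsFrom-ascent (N ∷ []) N≮p) (descentsFrom-ascent [] N≮N)))
                              (cong h (trans (descentsFrom-ascent (M ∷ []) N≮p) (descentsFrom-descent [] M<N))))
                   (cong₂ _+_ (cong h (trans (descentsFrom-descent (N ∷ []) M<p) (cong suc (descentsFrom-ascent [] N≮M))))
                              (cong h (trans (descentsFrom-descent (M ∷ []) M<p)
                                             (cong suc (descentsFrom-ascent [] M≮M))))) ⟩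
    h 0 + h 1 + (h 1 + h 1)
      ≡⟨ ring (h 0) (h 1) (h 2) ⟩
    insert₂ 0 0 h
      ∎
    where
    open ≡-Reasoning
    N≮p = ℤ.≤⇒≯ p≤N
    ring : ∀ X Y Z → X + Y + (Y + Y)
           ≡ (+ 2 * + 0 + + 1) * (+ 0 + + 1) * X
             + (+ 4 * + 0 * (+ 0 - + 0) + + 3 * + 0 + + 5 * (+ 0 - + 0) + + 3) * Y
             + (+ 0 - + 0) * (+ 2 * (+ 0 - + 0) + + 1) * Z
    ring = solve-∀
  insertSum-descents₂ {p} h (a ∷ v) M<p p≤N (a∈ ∷ v∈) = begin
    insertSum n 1 (λ w → h (descentsFrom (p ∷ N ∷ w))) (a ∷ v)
    + insertSum n 1 (λ w → h (descentsFrom (p ∷ M ∷ w))) (a ∷ v)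
    + insertSum n 2 (λ w → h (bit b ℕ.+ descentsFrom (a ∷ w))) v
      ≡⟨ cong₂ _+_ (cong₂ _+_ after-max after-min)
                   (insertSum-descents₂ (λ e → h (bit b ℕ.+ e)) v (min<interior a∈) (ℤ.<⇒≤ (interior<max a∈)) v∈) ⟩
    insert₁ (suc d) (suc m) h + (h (suc (suc d)) + h (suc d) + insert₁ d m (h ∘ suc))
    + insert₂ d m (λ e → h (bit b ℕ.+ e))
      ≡⟨ insert₂-step b d m h ⟩
    insert₂ (bit b ℕ.+ d) (suc m) h
      ∎
    where
    open ≡-Reasoning
    b = does (a ℤ.<? p)
    d = descentsFrom (a ∷ v)
    m = length v
    after-max : insertSum n 1 (λ w → h (descentsFrom (p ∷ N ∷ w))) (a ∷ v) ≡ insert₁ (suc d) (suc m) h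
    after-max = begin
      insertSum n 1 (λ w → h (descentsFrom (p ∷ N ∷ w))) (a ∷ v)
        ≡⟨ insertSum-cong n 1 (a ∷ v) (λ w → cong h (descentsFrom-ascent w (ℤ.≤⇒≯ p≤N))) ⟩
      insertSum n 1 (h ∘ descentsFrom ∘ (N ∷_)) (a ∷ v)
        ≡⟨ insertSum-descents₁ h (a ∷ v) M<N ℤ.≤-refl (a∈ ∷ v∈) ⟩
      insert₁ (descentsFrom (N ∷ a ∷ v)) (suc m) h
        ≡⟨ cong (λ e → insert₁ e (suc m) h) (descentsFrom-descent v (interior<max a∈)) ⟩
      insert₁ (suc d) (suc m) h
        ∎
    after-min : insertSum n 1 (λ w → h (descentsFrom (p ∷ M ∷ w))) (a ∷ v)
                ≡ h (suc (suc d)) + h (suc d) + insert₁ d m (h ∘ suc)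
    after-min = trans (insertSum-cong n 1 (a ∷ v) (λ w → cong h (descentsFrom-descent w M<p)))
                      (insertSum-descents₁-after-min (h ∘ suc) a v a∈ v∈)

α : ℤ → ℤ
α i = + 2 * i * i + + 3 * i + + 1

β : ℕ → ℤ → ℤ
β n i = + 2 * i * (+ 4 * + n - + 2 * i + + 3) + + 2 * + n + + 1

γ : ℕ → ℤ → ℤ
γ n i = (+ 2 * + n + + 2 - i) * (+ 4 * + n - + 2 * i + + 5)

insert₂-δ : ∀ n d i →
  insert₂ d (2 ℕ.* n) (δ i) ≡ α i * δ i d + β n i * δ (i - + 1) d + γ n i * δ (i - + 2) d
insert₂-δ n d i rewrite ℤ.pos-* 2 n =
  cong₂ _+_ (cong₂ _+_ (trans (cong (_* δ i d) (α-eq (+ d))) (δ-coeff α i d))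
                       (trans (cong (_* δ i (suc d)) (β-eq (+ d) (+ n))) (δ-coeff-+ 1 (β n) i d)))
            (trans (cong (_* δ i (suc (suc d))) (γ-eq (+ d) (+ n))) (δ-coeff-+ 2 (γ n) i d))
  where
  α-eq : ∀ D → (+ 2 * D + + 1) * (D + + 1) ≡ + 2 * D * D + + 3 * D + + 1
  α-eq = solve-∀
  β-eq : ∀ D N → + 4 * D * (+ 2 * N - D) + + 3 * D + + 5 * (+ 2 * N - D) + + 3
                 ≡ + 2 * (+ 1 + D) * (+ 4 * N - + 2 * (+ 1 + D) + + 3) + + 2 * N + + 1
  β-eq = solve-∀
  γ-eq : ∀ D N → (+ 2 * N - D) * (+ 2 * (+ 2 * N - D) + + 1)
                 ≡ (+ 2 * N + + 2 - (+ 2 + D)) * (+ 4 * N - + 2 * (+ 2 + D) + + 5)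
  γ-eq = solve-∀

P-suc≡∑-insertSum : ∀ n i →
  + P (suc n) i ≡ ∑[ v ∈ words (2 ℕ.* n) (alphabet n) ] (𝟙 (isSignedPermᵇ n v) * insertSum n 2 (δ i ∘ des) v)
P-suc≡∑-insertSum n i = begin
  + P (suc n) i
    ≡⟨ P≡∑ (suc n) i ⟩
  ∑[ w ∈ words (2 ℕ.* suc n) A' ] (𝟙 (isSignedPermᵇ (suc n) w) * δ i (des w))
    ≡⟨ cong (λ l → ∑[ w ∈ words l A' ] (𝟙 (isSignedPermᵇ (suc n) w) * δ i (des w))) 2+2n≡2n+2 ⟩
  ∑[ w ∈ words (2 ℕ.* n ℕ.+ 2) A' ] (𝟙 (isSignedPermᵇ (suc n) w) * δ i (des w))
    ≡⟨ ∑-cong (words (2 ℕ.* n ℕ.+ 2) A') (λ w →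
         trans (cong (_* δ i (des w)) (𝟙-isSignedPermᵇ-suc n w)) (regroup (ρ w) (𝟙-tops n 2 w) (δ i (des w)))) ⟩
  ∑[ w ∈ words (2 ℕ.* n ℕ.+ 2) A' ] (𝟙-tops n 2 w * (ρ w * δ i (des w)))
    ≡⟨ ∑-words-insertSum n 2 (2 ℕ.* n) _ ⟩
  ∑[ v ∈ words (2 ℕ.* n) (alphabet n) ] insertSum n 2 (λ w → ρ w * δ i (des w)) v
    ≡⟨ ∑-cong (words (2 ℕ.* n) (alphabet n)) (λ v → insertSum-*ˡ n ρ ρ-insert-top 2 [] v (δ i ∘ des)) ⟩
  ∑[ v ∈ words (2 ℕ.* n) (alphabet n) ] (ρ v * insertSum n 2 (δ i ∘ des) v)
    ∎
  where
  open ≡-Reasoning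
  A' = alphabet (suc n)
  ρ : List ℤ → ℤ
  ρ w = 𝟙 (isSignedPermᵇ n w)
  ρ-insert-top : ∀ {x} u w → ∣ x ∣ ≡ suc n → ρ (u ++ x ∷ w) ≡ ρ (u ++ w)
  ρ-insert-top u w ∣x∣≡1+n = cong 𝟙 (isSignedPermᵇ-insert-top n u w ∣x∣≡1+n)
  2+2n≡2n+2 : 2 ℕ.* suc n ≡ 2 ℕ.* n ℕ.+ 2
  2+2n≡2n+2 = trans (ℕ.*-suc 2 n) (ℕ.+-comm 2 (2 ℕ.* n))
  regroup : ∀ r t e → r * t * e ≡ t * (r * e)
  regroup = solve-∀

lemma2p2 : (n : ℕ) → 1 ≤ n → (i : ℤ) →
    + P (suc n) i ≡
      (+ 2 * i * i + + 3 * i + + 1) * + P n i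
      + (+ 2 * i * (+ 4 * + n - + 2 * i + + 3) + + 2 * + n + + 1) * + P n (i - + 1)
      + (+ 2 * + n + + 2 - i) * (+ 4 * + n - + 2 * i + + 5) * + P n (i - + 2)
lemma2p2 n _ i = begin
  + P (suc n) i
    ≡⟨ P-suc≡∑-insertSum n i ⟩
  ∑[ v ∈ W ] (ρ v * insertSum n 2 (δ i ∘ des) v)
    ≡⟨ ∑-words-cong-All (2 ℕ.* n) (alphabet-interior n) (λ {v} len≡2n v∈ → cong (ρ v *_) (begin
         insertSum n 2 (δ i ∘ des) v            ≡⟨ insertSum-descents₂ n (δ i) v ℤ.-<+ (ℤ.+≤+ z≤n) v∈ ⟩
         insert₂ (des v) (length v) (δ i)       ≡⟨ cong (λ m → insert₂ (des v) m (δ i)) len≡2n ⟩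
         insert₂ (des v) (2 ℕ.* n) (δ i)        ≡⟨ insert₂-δ n (des v) i ⟩
         α i * δ i (des v) + β n i * δ (i - + 1) (des v) + γ n i * δ (i - + 2) (des v) ∎)) ⟩
  ∑[ v ∈ W ] (ρ v * (α i * δ i (des v) + β n i * δ (i - + 1) (des v) + γ n i * δ (i - + 2) (des v)))
    ≡⟨ ∑-*-+₃ W ρ _ _ _ (α i) (β n i) (γ n i) ⟩
  α i * ∑[ v ∈ W ] (ρ v * δ i (des v)) + β n i * ∑[ v ∈ W ] (ρ v * δ (i - + 1) (des v))
    + γ n i * ∑[ v ∈ W ] (ρ v * δ (i - + 2) (des v))
    ≡⟨ cong₂ _+_ (cong₂ _+_ (cong (α i *_) (P≡∑ n i)) (cong (β n i *_) (P≡∑ n (i - + 1))))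
                 (cong (γ n i *_) (P≡∑ n (i - + 2))) ⟨
  α i * + P n i + β n i * + P n (i - + 1) + γ n i * + P n (i - + 2)
    ∎
  where
  open ≡-Reasoning
  W = words (2 ℕ.* n) (alphabet n)
  ρ : List ℤ → ℤ
  ρ v = 𝟙 (isSignedPermᵇ n v)
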